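{- Let $G$ be a graph and $R\subseteq V(G)$ an independent set of terminals with $|R|\ge 2$. Then $G$ has an $R$-CIST of size $k$ if and only if there exist pairwise disjoint subsets $V_1,\dots,V_k$ of $V(G)$ such that each $V_i$ is a connected $R$-dominating set.
   Context: Graphs are finite and connected, may have parallel edges but no loops. For a tree $T$, $\mathrm{int}(T)$ is the set of vertices of degree at least 2 in $T$ and $L(T)$ the set of leaves. An $R$-Steiner tree is a subtree $T$ with $R\subseteq V(T)$ and $L(T)\subseteq R$; $T(u,v)$ is the unique $(u,v)$-path in $T$. An $R$-CIST of size $k$ is a set $\{T_1,\dots,T_k\}$ of $R$-Steiner trees such that for all distinct $u,v\in R$ and distinct $i,j$, $T_i(u,v)$ and $T_j(u,v)$ are edge-disjoint and internally vertex-disjoint. A set $Q\subseteq V(G)$ is a connected $R$-dominating set if $G[Q]$ is connected and every vertex of $R$ lies in $Q$ or is adjacent to a vertex of $Q$. -}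

module Defs where

open import Data.Nat using (ℕ; zero; suc; _+_; _≤_)
open import Data.Fin using (Fin; _≟_)
open import Data.Fin.Subset using (Subset; ∣_∣) renaming (_∈_ to _∈ₛ_; _∉_ to _∉ₛ_)
open import Data.Fin.Subset.Properties using (_∈?_)
open import Data.List using (List; []; _∷_; map; allFin)
open import Data.Nat.ListAction using (sum)
open import Data.List.Membership.Propositional using () renaming (_∈_ to _∈ₗ_; _∉_ to _∉ₗ_)
open import Data.List.Relation.Unary.All using (All)
open import Data.List.Relation.Unary.Unique.Propositional using (Unique)
open import Data.Product using (Σ; ∃; _×_; _,_; proj₁; proj₂)
open import Data.Sum using (_⊎_)
open import Data.Empty using (⊥)
open import Relation.Nullary using (¬_; yes; no)
open import Relation.Binary.PropositionalEquality using (_≡_; _≢_)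

-- A finite multigraph without loops: vertices Fin n, edges Fin m
-- (parallel edges = distinct edge indices with the same endpoints).
record Graph : Set where
  field
    n     : ℕ
    m     : ℕ
    ends  : Fin m → Fin n × Fin n
    loopless : ∀ e → proj₁ (ends e) ≢ proj₂ (ends e)
open Graph public

module _ (G : Graph) where

  Joins : Fin (m G) → Fin (n G) → Fin (n G) → Set
  Joins e u w = ends G e ≡ (u , w) ⊎ ends G e ≡ (w , u)

  data Walk : Fin (n G) → Fin (n G) → Set where
    []   : ∀ {u} → Walk u u
    step : ∀ {u w v} (e : Fin (m G)) → Joins e u w → Walk w v → Walk u v

  verts : ∀ {u v} → Walk u v → List (Fin (n G))
  verts {u} []           = u ∷ []
  verts {u} (step e _ p) = u ∷ verts p

  edges : ∀ {u v} → Walk u v → List (Fin (m G))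
  edges []           = []
  edges (step e _ p) = e ∷ edges p

  IsPath : ∀ {u v} → Walk u v → Set
  IsPath p = Unique (verts p)

  Connected : Set
  Connected = ∀ u v → Walk u v

  Independent : Subset (n G) → Set
  Independent R = ∀ e u w → Joins e u w → u ∈ₛ R → w ∈ₛ R → ⊥

  record Subgraph : Set where
    constructor sub
    field
      VS : Subset (n G)
      ES : Subset (m G)
      closed : ∀ e → e ∈ₛ ES → proj₁ (ends G e) ∈ₛ VS × proj₂ (ends G e) ∈ₛ VS
  open Subgraph public

  WalkIn : Subgraph → ∀ {u v} → Walk u v → Set
  WalkIn H p = All (_∈ₛ VS H) (verts p) × All (_∈ₛ ES H) (edges p)

  PathIn : Subgraph → Fin (n G) → Fin (n G) → Set
  PathIn H u v = Σ (Walk u v) λ p → IsPath p × WalkIn H p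

  SubConnected : Subgraph → Set
  SubConnected H = ∀ u v → u ∈ₛ VS H → v ∈ₛ VS H → PathIn H u v

  HasCycle : Subgraph → Set
  HasCycle H = Σ (Fin (n G)) λ u → Σ (Fin (n G)) λ v → u ≢ v ×
    Σ (PathIn H u v) λ P → Σ (Fin (m G)) λ e →
      e ∈ₛ ES H × Joins e v u × e ∉ₗ edges (proj₁ P)

  IsTree : Subgraph → Set
  IsTree H = (Σ (Fin (n G)) λ x → x ∈ₛ VS H) × SubConnected H × ¬ HasCycle H

  incident : Fin (m G) → Fin (n G) → ℕ
  incident e x with x ≟ proj₁ (ends G e) | x ≟ proj₂ (ends G e)
  ... | yes _ | _     = 1
  ... | no _  | yes _ = 1
  ... | no _  | no _  = 0

  degree : Subgraph → Fin (n G) → ℕ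
  degree H x = sum (map (λ e → count e) (allFin (m G)))
    where
      count : Fin (m G) → ℕ
      count e with e ∈? ES H
      ... | yes _ = incident e x
      ... | no _  = 0

  IsLeaf : Subgraph → Fin (n G) → Set
  IsLeaf H x = x ∈ₛ VS H × degree H x ≡ 1

  SteinerTree : Subset (n G) → Subgraph → Set
  SteinerTree R T = IsTree T × (∀ x → x ∈ₛ R → x ∈ₛ VS T)
                    × (∀ x → IsLeaf T x → x ∈ₛ R)

  OpenDisjoint : ∀ {u v} → Walk u v → Walk u v → Set
  OpenDisjoint {u} {v} p q =
    (∀ e → e ∈ₗ edges p → e ∈ₗ edges q → ⊥) ×
    (∀ x → x ∈ₗ verts p → x ∈ₗ verts q → x ≡ u ⊎ x ≡ v)

  -- an R-CIST of size k: R-Steiner trees T₁ … T_k such that for distinct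
  -- u,v ∈ R and i ≠ j, T_i(u,v) and T_j(u,v) are edge-disjoint and internally
  -- vertex-disjoint (T(u,v) being the (unique) path of T from u to v)
  CIST : Subset (n G) → (k : ℕ) → (Fin k → Subgraph) → Set
  CIST R k T = (∀ i → SteinerTree R (T i)) ×
    (∀ u v → u ∈ₛ R → v ∈ₛ R → u ≢ v → ∀ i j → i ≢ j →
       (P : PathIn (T i) u v) → (Q : PathIn (T j) u v) →
       OpenDisjoint (proj₁ P) (proj₁ Q))

  HasCIST : Subset (n G) → ℕ → Set
  HasCIST R k = Σ (Fin k → Subgraph) λ T → CIST R k T

  InducedConnected : Subset (n G) → Set
  InducedConnected Q = ∀ u v → u ∈ₛ Q → v ∈ₛ Q →
    Σ (Walk u v) λ p → All (_∈ₛ Q) (verts p)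

  ConnDominating : Subset (n G) → Subset (n G) → Set
  ConnDominating R Q = InducedConnected Q ×
    (∀ r → r ∈ₛ R → r ∈ₛ Q ⊎ Σ (Fin (m G)) λ e → Σ (Fin (n G)) λ q → Joins e r q × q ∈ₛ Q)

  PairwiseDisjoint : ∀ {k} → (Fin k → Subset (n G)) → Set
  PairwiseDisjoint V = ∀ i j → i ≢ j → ∀ x → x ∈ₛ V i → x ∈ₛ V j → ⊥

{-# OPTIONS --safe #-}
module Submission where

-- (⇒) Take V_i = int(T_i). A vertex x of degree ≥ 2 in a Steiner tree lies strictly inside the tree
-- path between two terminals: extend a path through x as far as possible in both directions; its
-- ends have degree 1, so they are leaves, hence terminals. In a tree the relation "x lies on the
-- path from a to b" is symmetric and satisfies: x on b–c implies x on a–b or on a–c. Hence if x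
-- were inside T_i(u₁,v₁) and T_j(u₂,v₂), it would lie inside T_i(a,b) and T_j(a,b) for one pair of
-- terminals a, b, against the CIST condition. int(T_i) is connected since inner vertices of tree
-- paths have degree ≥ 2, and it dominates R since the second vertex of a path from r to another
-- terminal is not a terminal (R is independent).
--
-- (⇐) Grow a tree from a vertex of V_i, attaching along edges from a V_i-vertex of the tree to a
-- vertex of V_i ∪ R outside it, so that vertices outside V_i stay leaves. When no such edge is left
-- the tree contains V_i (G[V_i] is connected) and R (V_i dominates R); then prune leaves outside R.
-- Inner vertices of paths in the resulting Steiner trees lie in V_i, so paths of different trees
-- share only their ends, and a common edge would join two terminals.

open import Defs
open import Data.Nat using (ℕ; _≤_)
open import Data.Fin using (Fin)
open import Data.Fin.Subset using (Subset; ∣_∣)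
open import Data.Product using (Σ; _×_)
open import Function.Bundles using (_⇔_)

open import Data.Empty using (⊥; ⊥-elim)
open import Data.Fin using (_≟_)
open import Data.Fin.Properties using (any?)
open import Data.Fin.Subset using (_⊂_; _⊃_; ⁅_⁆; _∪_)
  renaming (⊥ to ⊥ₛ; _∈_ to _∈ₛ_; _∉_ to _∉ₛ_; _⊆_ to _⊆ₛ_)
open import Data.Fin.Subset.Induction using (⊂-wellFounded; ⊃-wellFounded)
open import Data.Fin.Subset.Properties
  using (_∈?_; p⊆q⇒∣p∣≤∣q∣; ∣⁅x⁆∣≡1; x∈⁅x⁆; x∈⁅y⁆⇒x≡y; ∣⊥∣≡0; ∉⊥; x∈p∪q⁻; x∈p∪q⁺)
open import Data.List using (List; []; _∷_; map; allFin)
open import Data.List.Membership.Propositional using (_∈_; _∉_)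
open import Data.List.Membership.Propositional.Properties using (∈-allFin)
open import Data.List.Relation.Binary.Subset.Propositional using (_⊆_)
open import Data.List.Relation.Binary.Subset.Propositional.Properties using (⊆-refl; ⊆-trans)
open import Data.List.Relation.Unary.All as All using (All; [])
open import Data.List.Relation.Unary.All.Properties using (¬Any⇒All¬)
open import Data.List.Relation.Unary.AllPairs using ([]; _∷_)
open import Data.List.Relation.Unary.Any as Any using (here; there)
open import Data.List.Relation.Unary.Unique.Propositional using (Unique)
open import Data.List.Relation.Unary.Unique.Propositional.Properties using (allFin⁺)
open import Data.Nat using (_+_; z≤n; _≤?_)
open import Data.Nat.ListAction using (sum)
open import Data.Nat.Properties
  using (n≤1+n; ≰⇒>; <⇒≱; ≤-trans; ≤-refl; ≤-reflexive; ≤-antisym; +-mono-≤; m≤m+n; m≤n+m; +-comm;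
         +-identityʳ)
open import Data.Product using (_,_; proj₁; proj₂)
open import Data.Sum using (_⊎_; inj₁; inj₂; [_,_]′) renaming (map to map-⊎)
open import Data.Vec using (tabulate)
open import Data.Vec.Properties using (lookup∘tabulate; lookup⇒[]=; []=⇒lookup)
open import Function using (id)
open import Function.Bundles using (mk⇔)
open import Induction.WellFounded using (Acc; acc)
open import Relation.Binary.PropositionalEquality
  using (_≡_; _≢_; refl; sym; trans; cong; cong₂; ≢-sym; subst)
open import Relation.Nullary using (¬_; Dec; yes; no; does)
open import Relation.Nullary.Decidable using (dec-true; _×-dec_; _⊎-dec_; ¬?; decidable-stable)
open import Relation.Unary using (Decidable)

⟦_⟧ : ∀ {k} {P : Fin k → Set} → Decidable P → Subset k
⟦ P? ⟧ = tabulate (λ i → does (P? i))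

∈⟦⟧⁺ : ∀ {k} {P : Fin k → Set} (P? : Decidable P) {i} → P i → i ∈ₛ ⟦ P? ⟧
∈⟦⟧⁺ P? {i} p = lookup⇒[]= i _ (trans (lookup∘tabulate _ i) (dec-true (P? i) p))

∈⟦⟧⁻ : ∀ {k} {P : Fin k → Set} (P? : Decidable P) {i} → i ∈ₛ ⟦ P? ⟧ → P i
∈⟦⟧⁻ P? {i} i∈ with P? i | trans (sym (lookup∘tabulate (λ j → does (P? j)) i)) ([]=⇒lookup i∈)
... | yes p | _ = p
... | no _  | ()

∈-∪⁅⁆⁻ : ∀ {k} (p : Subset k) y {x} → x ∈ₛ p ∪ ⁅ y ⁆ → x ∈ₛ p ⊎ x ≡ y
∈-∪⁅⁆⁻ p y x∈ = map-⊎ id (x∈⁅y⁆⇒x≡y y) (x∈p∪q⁻ p ⁅ y ⁆ x∈)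

∈-∪⁅⁆⁺ : ∀ {k} {p : Subset k} {x} y → x ∈ₛ p → x ∈ₛ p ∪ ⁅ y ⁆
∈-∪⁅⁆⁺ y x∈ = x∈p∪q⁺ (inj₁ x∈)

y∈-∪⁅y⁆ : ∀ {k} {p : Subset k} y → y ∈ₛ p ∪ ⁅ y ⁆
y∈-∪⁅y⁆ y = x∈p∪q⁺ (inj₂ (x∈⁅x⁆ y))

module _ {A : Set} (c : A → ℕ) where

  ∈⇒≤sum : ∀ {x xs} → x ∈ xs → c x ≤ sum (map c xs)
  ∈⇒≤sum {xs = y ∷ ys} (here refl) = m≤m+n (c y) _
  ∈⇒≤sum {xs = y ∷ ys} (there x∈) = ≤-trans (∈⇒≤sum x∈) (m≤n+m _ (c y))

  ≢∈⇒+≤sum : ∀ {x y xs} → x ≢ y → x ∈ xs → y ∈ xs → c x + c y ≤ sum (map c xs)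
  ≢∈⇒+≤sum x≢y (here refl) (here refl) = ⊥-elim (x≢y refl)
  ≢∈⇒+≤sum x≢y (here refl) (there y∈) = +-mono-≤ ≤-refl (∈⇒≤sum y∈)
  ≢∈⇒+≤sum {x} {y} x≢y (there x∈) (here refl) =
    ≤-trans (≤-reflexive (+-comm (c x) (c y))) (+-mono-≤ ≤-refl (∈⇒≤sum x∈))
  ≢∈⇒+≤sum {xs = z ∷ _} x≢y (there x∈) (there y∈) = ≤-trans (≢∈⇒+≤sum x≢y x∈ y∈) (m≤n+m _ (c z))

  sum-map-zero : ∀ {xs} → (∀ {y} → y ∈ xs → c y ≡ 0) → sum (map c xs) ≡ 0
  sum-map-zero {[]} _ = refl
  sum-map-zero {y ∷ ys} vanish rewrite vanish (here refl) = sum-map-zero (λ y∈ → vanish (there y∈))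

module _ {k} (c : Fin k → ℕ) where

  unique-sum≤ : ∀ {x xs} → Unique xs → (∀ {y} → y ≢ x → c y ≡ 0) → sum (map c xs) ≤ c x
  unique-sum≤ {xs = []} _ _ = z≤n
  unique-sum≤ {x} {y ∷ ys} (y∉ys ∷ uniq) vanish with y ≟ x
  ... | yes refl rewrite sum-map-zero c {ys} (λ z∈ → vanish (≢-sym (All.lookup y∉ys z∈))) =
    ≤-reflexive (+-identityʳ (c y))
  ... | no y≢x rewrite vanish y≢x = unique-sum≤ uniq vanish

∃-other-element : ∀ {k} (p : Subset k) → 2 ≤ ∣ p ∣ → ∀ r → Σ (Fin k) λ r' → r' ∈ₛ p × r' ≢ r
∃-other-element p 2≤∣p∣ r with any? (λ r' → (r' ∈? p) ×-dec ¬? (r' ≟ r))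
... | yes found = found
... | no none = ⊥-elim (<⇒≱ 2≤∣p∣ (≤-trans (p⊆q⇒∣p∣≤∣q∣ p⊆⁅r⁆) (≤-reflexive (∣⁅x⁆∣≡1 r))))
  where
  p⊆⁅r⁆ : p ⊆ₛ ⁅ r ⁆
  p⊆⁅r⁆ {r'} r'∈ with r' ≟ r
  ... | yes refl = x∈⁅x⁆ r
  ... | no r'≢r  = ⊥-elim (none (r' , r'∈ , r'≢r))

∃-element : ∀ {k} (p : Subset k) → 1 ≤ ∣ p ∣ → Σ (Fin k) (_∈ₛ p)
∃-element {k} p 1≤∣p∣ with any? (_∈? p)
... | yes found = found
... | no none = ⊥-elim (<⇒≱ 1≤∣p∣ (≤-trans (p⊆q⇒∣p∣≤∣q∣ {q = ⊥ₛ} (λ r∈ → ⊥-elim (none (_ , r∈))))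
                                          (≤-reflexive (∣⊥∣≡0 k))))

-- S₁ a b and S₂ a b stand for "x lies on the path from a to b" in two trees.
module _ {A : Set} {Terminal : A → Set} {S₁ S₂ : A → A → Set}
         (sym₁ : ∀ {a b} → S₁ a b → S₁ b a) (sym₂ : ∀ {a b} → S₂ a b → S₂ b a)
         (split₁ : ∀ {a b c} → Terminal a → S₁ b c → S₁ a b ⊎ S₁ a c)
         (split₂ : ∀ {a b c} → Terminal a → S₂ b c → S₂ a b ⊎ S₂ a c) where

  CommonPair : Set
  CommonPair = Σ A λ a → Σ A λ b → Terminal a × Terminal b × S₁ a b × S₂ a b

  common-separated-pair : ∀ {u₁ v₁ u₂ v₂} → Terminal u₁ → Terminal v₁ → Terminal u₂ → Terminal v₂ →
                          S₁ u₁ v₁ → S₂ u₂ v₂ → CommonPair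
  common-separated-pair {u₁} {v₁} tu₁ tv₁ tu₂ tv₂ s₁ s₂ = [ via tu₂ , via tv₂ ]′ (split₂ tu₁ s₂)
    where
    via : ∀ {w} → Terminal w → S₂ u₁ w → CommonPair
    via {w} tw s₂u₁w with split₁ tw s₁
    ... | inj₁ s₁wu₁ = u₁ , w , tu₁ , tw , sym₁ s₁wu₁ , s₂u₁w
    ... | inj₂ s₁wv₁ with split₂ tv₁ s₂u₁w
    ...   | inj₁ s₂v₁u₁ = u₁ , v₁ , tu₁ , tv₁ , s₁ , sym₂ s₂v₁u₁
    ...   | inj₂ s₂v₁w  = v₁ , w , tv₁ , tw , sym₁ s₁wv₁ , s₂v₁w

module _ (G : Graph) where

  private
    V = Fin (n G)
    E = Fin (m G)

    _∈ₗ?_ : ∀ (x : V) xs → Dec (x ∈ xs)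
    x ∈ₗ? xs = Any.any? (x ≟_) xs

  Incident : E → V → Set
  Incident e x = x ≡ proj₁ (ends G e) ⊎ x ≡ proj₂ (ends G e)

  incident? : ∀ e x → Dec (Incident e x)
  incident? e x = (x ≟ proj₁ (ends G e)) ⊎-dec (x ≟ proj₂ (ends G e))

  -- The end of e opposite to x, provided x is an end of e.
  other : E → V → V
  other e x with x ≟ proj₁ (ends G e)
  ... | yes _ = proj₂ (ends G e)
  ... | no _  = proj₁ (ends G e)

  joins⇒incidentˡ : ∀ {e u w} → Joins G e u w → Incident e u
  joins⇒incidentˡ (inj₁ refl) = inj₁ refl
  joins⇒incidentˡ (inj₂ refl) = inj₂ refl

  joins⇒incidentʳ : ∀ {e u w} → Joins G e u w → Incident e w
  joins⇒incidentʳ (inj₁ refl) = inj₂ refl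
  joins⇒incidentʳ (inj₂ refl) = inj₁ refl

  joins-sym : ∀ {e u w} → Joins G e u w → Joins G e w u
  joins-sym (inj₁ eq) = inj₂ eq
  joins-sym (inj₂ eq) = inj₁ eq

  joins⇒≢ : ∀ {e u w} → Joins G e u w → u ≢ w
  joins⇒≢ {e} (inj₁ eq) refl = loopless G e (trans (cong proj₁ eq) (sym (cong proj₂ eq)))
  joins⇒≢ {e} (inj₂ eq) refl = loopless G e (trans (cong proj₁ eq) (sym (cong proj₂ eq)))

  incident-joins : ∀ {e u w z} → Joins G e u w → Incident e z → z ≡ u ⊎ z ≡ w
  incident-joins (inj₁ refl) (inj₁ refl) = inj₁ refl
  incident-joins (inj₁ refl) (inj₂ refl) = inj₂ refl
  incident-joins (inj₂ refl) (inj₁ refl) = inj₂ refl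
  incident-joins (inj₂ refl) (inj₂ refl) = inj₁ refl

  joins-functional : ∀ {e u w w'} → Joins G e u w → Joins G e u w' → w ≡ w'
  joins-functional j j' with incident-joins j (joins⇒incidentʳ j')
  ... | inj₁ refl = ⊥-elim (joins⇒≢ j' refl)
  ... | inj₂ w'≡w = sym w'≡w

  incident⇒joins-other : ∀ {e x} → Incident e x → Joins G e x (other e x)
  incident⇒joins-other {e} {x} inc with x ≟ proj₁ (ends G e) | inc
  ... | yes refl | _        = inj₁ refl
  ... | no x≢s   | inj₁ x≡s = ⊥-elim (x≢s x≡s)
  ... | no _     | inj₂ refl = inj₂ refl

  joins⇒≡other : ∀ {e x w} → Joins G e x w → w ≡ other e x
  joins⇒≡other j = joins-functional j (incident⇒joins-other (joins⇒incidentˡ j))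

  IncidentIn : Subgraph G → V → E → Set
  IncidentIn H x e = e ∈ₛ ES H × Incident e x

  AtMostOneEdgeAt : Subgraph G → V → Set
  AtMostOneEdgeAt H x = ∀ {e e'} → IncidentIn H x e → IncidentIn H x e' → e ≡ e'

  incidentIn⇒∈VS : ∀ H {x e} → IncidentIn H x e → x ∈ₛ VS H
  incidentIn⇒∈VS H {e = e} (e∈ , inj₁ refl) = proj₁ (closed H e e∈)
  incidentIn⇒∈VS H {e = e} (e∈ , inj₂ refl) = proj₂ (closed H e e∈)

  -- degree sums an edge counter local to its definition in Defs; this names that counter.
  private
    incidence-count : ∀ H x → Σ (E → ℕ) λ c → degree G H x ≡ sum (map c (allFin (m G)))
    incidence-count H x = _ , refl

    count : Subgraph G → V → E → ℕ
    count H x = proj₁ (incidence-count H x)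

    incident-one : ∀ {e x} → Incident e x → incident G e x ≡ 1
    incident-one {e} {x} inc with x ≟ proj₁ (ends G e) | x ≟ proj₂ (ends G e) | inc
    ... | yes _ | _     | _        = refl
    ... | no _  | yes _ | _        = refl
    ... | no ¬s | no _  | inj₁ x≡s = ⊥-elim (¬s x≡s)
    ... | no _  | no ¬t | inj₂ x≡t = ⊥-elim (¬t x≡t)

    incident-zero : ∀ {e x} → ¬ Incident e x → incident G e x ≡ 0
    incident-zero {e} {x} ¬inc with x ≟ proj₁ (ends G e) | x ≟ proj₂ (ends G e)
    ... | yes x≡s | _       = ⊥-elim (¬inc (inj₁ x≡s))
    ... | no _    | yes x≡t = ⊥-elim (¬inc (inj₂ x≡t))
    ... | no _    | no _    = refl

    count-incident : ∀ H x {e} → IncidentIn H x e → count H x e ≡ 1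
    count-incident H x {e} (e∈ , inc) with e ∈? ES H
    ... | yes _ = incident-one inc
    ... | no e∉ = ⊥-elim (e∉ e∈)

    count-not-incident : ∀ H x {e} → ¬ IncidentIn H x e → count H x e ≡ 0
    count-not-incident H x {e} ¬inc with e ∈? ES H
    ... | yes e∈ = incident-zero (λ inc → ¬inc (e∈ , inc))
    ... | no _   = refl

  degree≥1 : ∀ H {x e} → IncidentIn H x e → 1 ≤ degree G H x
  degree≥1 H {x} {e} inc rewrite proj₂ (incidence-count H x) =
    ≤-trans (≤-reflexive (sym (count-incident H x inc))) (∈⇒≤sum (count H x) (∈-allFin e))

  degree≥2 : ∀ H {x e e'} → e ≢ e' → IncidentIn H x e → IncidentIn H x e' → 2 ≤ degree G H x
  degree≥2 H {x} {e} {e'} e≢e' inc inc' rewrite proj₂ (incidence-count H x) =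
    ≤-trans (≤-reflexive (sym (cong₂ _+_ (count-incident H x inc) (count-incident H x inc'))))
            (≢∈⇒+≤sum (count H x) e≢e' (∈-allFin e) (∈-allFin e'))

  degree≤1⇒atMostOne : ∀ H {x} → degree G H x ≤ 1 → AtMostOneEdgeAt H x
  degree≤1⇒atMostOne H d≤1 {e} {e'} inc inc' with e ≟ e'
  ... | yes e≡e' = e≡e'
  ... | no e≢e'  = ⊥-elim (<⇒≱ (degree≥2 H e≢e' inc inc') d≤1)

  atMostOne⇒degree≤1 : ∀ H {x} → AtMostOneEdgeAt H x → degree G H x ≤ 1
  atMostOne⇒degree≤1 H {x} one rewrite proj₂ (incidence-count H x)
    with any? (λ e → (e ∈? ES H) ×-dec incident? e x)
  ... | yes (e , inc) = ≤-trans (unique-sum≤ (count H x) (allFin⁺ (m G)) zero-elsewhere)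
                                (≤-reflexive (count-incident H x inc))
    where
    zero-elsewhere : ∀ {e'} → e' ≢ e → count H x e' ≡ 0
    zero-elsewhere e'≢e = count-not-incident H x (λ inc' → e'≢e (one inc' inc))
  ... | no none = ≤-trans (≤-reflexive (sum-map-zero (count H x) {allFin (m G)} λ {e} _ →
                              count-not-incident H x (λ inc → none (e , inc)))) z≤n

  _++ʷ_ : ∀ {u v w} → Walk G u v → Walk G v w → Walk G u w
  []         ++ʷ q = q
  step e j p ++ʷ q = step e j (p ++ʷ q)

  reverse : ∀ {u v} → Walk G u v → Walk G v u
  reverse []           = []
  reverse (step e j p) = reverse p ++ʷ step e (joins-sym j) []

  infix 4 _≼_
  record _≼_ {u v u' v'} (q : Walk G u v) (p : Walk G u' v') : Set where
    constructor _,_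
    field
      verts⊆ : verts G q ⊆ verts G p
      edges⊆ : edges G q ⊆ edges G p
  open _≼_ public

  ≼-refl : ∀ {u v} {p : Walk G u v} → p ≼ p
  ≼-refl = ⊆-refl , ⊆-refl

  ≼-trans : ∀ {u v u' v' u'' v''} {p : Walk G u v} {q : Walk G u' v'} {r : Walk G u'' v''} →
            p ≼ q → q ≼ r → p ≼ r
  ≼-trans (vs₁ , es₁) (vs₂ , es₂) = ⊆-trans vs₁ vs₂ , ⊆-trans es₁ es₂

  start∈verts : ∀ {u v} (p : Walk G u v) → u ∈ verts G p
  start∈verts []           = here refl
  start∈verts (step _ _ _) = here refl

  end∈verts : ∀ {u v} (p : Walk G u v) → v ∈ verts G p
  end∈verts []           = here refl
  end∈verts (step _ _ p) = there (end∈verts p)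

  incident∈verts : ∀ {u v} (p : Walk G u v) {e z} → e ∈ edges G p → Incident e z → z ∈ verts G p
  incident∈verts (step _ j p) (here refl) inc with incident-joins j inc
  ... | inj₁ refl = here refl
  ... | inj₂ refl = there (start∈verts p)
  incident∈verts (step _ _ p) (there e∈) inc = there (incident∈verts p e∈ inc)

  ∈-verts-++⁻ : ∀ {u v w} (p : Walk G u v) (q : Walk G v w) {x} →
                x ∈ verts G (p ++ʷ q) → x ∈ verts G p ⊎ x ∈ verts G q
  ∈-verts-++⁻ []           q x∈         = inj₂ x∈
  ∈-verts-++⁻ (step _ _ p) q (here refl) = inj₁ (here refl)
  ∈-verts-++⁻ (step _ _ p) q (there x∈) with ∈-verts-++⁻ p q x∈
  ... | inj₁ x∈p = inj₁ (there x∈p)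
  ... | inj₂ x∈q = inj₂ x∈q

  ∈-edges-++⁻ : ∀ {u v w} (p : Walk G u v) (q : Walk G v w) {e} →
                e ∈ edges G (p ++ʷ q) → e ∈ edges G p ⊎ e ∈ edges G q
  ∈-edges-++⁻ []           q e∈         = inj₂ e∈
  ∈-edges-++⁻ (step _ _ p) q (here refl) = inj₁ (here refl)
  ∈-edges-++⁻ (step _ _ p) q (there e∈) with ∈-edges-++⁻ p q e∈
  ... | inj₁ e∈p = inj₁ (there e∈p)
  ... | inj₂ e∈q = inj₂ e∈q

  reverse≼ : ∀ {u v} (p : Walk G u v) → reverse p ≼ p
  reverse≼ []           = ≼-refl
  reverse≼ (step e j p) = reverse-verts , reverse-edges
    where
    reverse-verts : verts G (reverse (step e j p)) ⊆ verts G (step e j p)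
    reverse-verts x∈ with ∈-verts-++⁻ (reverse p) (step e (joins-sym j) []) x∈
    ... | inj₁ x∈p                 = there (verts⊆ (reverse≼ p) x∈p)
    ... | inj₂ (here refl)         = there (start∈verts p)
    ... | inj₂ (there (here refl)) = here refl
    reverse-edges : edges G (reverse (step e j p)) ⊆ edges G (step e j p)
    reverse-edges f∈ with ∈-edges-++⁻ (reverse p) (step e (joins-sym j) []) f∈
    ... | inj₁ f∈p         = there (edges⊆ (reverse≼ p) f∈p)
    ... | inj₂ (here refl) = here refl

  step≼ : ∀ {u w v v' e} (j : Joins G e u w) (p : Walk G w v) {q : Walk G w v'} →
          q ≼ p → step e j q ≼ step e j p
  step≼ j p (vs , es) = (λ { (here refl) → here refl ; (there x∈) → there (vs x∈) })
                      , (λ { (here refl) → here refl ; (there f∈) → there (es f∈) })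

  tail≼ : ∀ {u w v e} (j : Joins G e u w) (p : Walk G w v) → p ≼ step e j p
  tail≼ j p = there , there

  suffix : ∀ {u v} (p : Walk G u v) → IsPath G p → ∀ {x} → x ∈ verts G p →
           Σ (Walk G x v) λ q → IsPath G q × q ≼ p
  suffix []           path (here refl) = [] , path , ≼-refl
  suffix (step e j p) path (here refl) = step e j p , path , ≼-refl
  suffix (step e j p) (_ ∷ path) (there x∈) with suffix p path x∈
  ... | q , q-path , q≼p = q , q-path , ≼-trans q≼p (tail≼ j p)

  prefix : ∀ {u v} (p : Walk G u v) {x} → x ∈ verts G p → Σ (Walk G u x) λ q → q ≼ p
  prefix []           (here refl) = [] , ≼-refl
  prefix (step e j p) (here refl) = [] , (λ { (here refl) → here refl }) , λ ()
  prefix (step e j p) (there x∈) with prefix p x∈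
  ... | q , q≼p = step e j q , step≼ j p q≼p

  shortcut : ∀ {u v} (p : Walk G u v) → Σ (Walk G u v) λ q → IsPath G q × q ≼ p
  shortcut []                = [] , ([] ∷ []) , ≼-refl
  shortcut {u} (step e j p) with shortcut p
  ... | q , q-path , q≼p with u ∈ₗ? verts G q
  ...   | no u∉q  = step e j q , (¬Any⇒All¬ _ u∉q ∷ q-path) , step≼ j p q≼p
  ...   | yes u∈q = let (r , r-path , r≼q) = suffix q q-path u∈q in
                    r , r-path , ≼-trans r≼q (≼-trans q≼p (tail≼ j p))

  closed-path-trivial : ∀ {u} (p : Walk G u u) → IsPath G p → ∀ {x} → x ∈ verts G p → x ≡ u
  closed-path-trivial []           _             (here refl) = refl
  closed-path-trivial (step _ _ p) (u∉p ∷ _) _ = ⊥-elim (All.lookup u∉p (end∈verts p) refl)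

  first-edge : ∀ {u v} (p : Walk G u v) → u ≢ v → Σ E λ e → e ∈ edges G p × Incident e u
  first-edge []           u≢v = ⊥-elim (u≢v refl)
  first-edge (step e j _) _   = e , here refl , joins⇒incidentˡ j

  last-edge : ∀ {u v} (p : Walk G u v) → u ≢ v → Σ E λ e → e ∈ edges G p × Incident e v
  last-edge []                       u≢v = ⊥-elim (u≢v refl)
  last-edge {v = v} (step {w = w} e j p) _ with w ≟ v
  ... | yes refl = e , here refl , joins⇒incidentʳ j
  ... | no w≢v with last-edge p w≢v
  ...   | f , f∈ , inc = f , there f∈ , inc

  TwoEdgesAt : ∀ {u v} → Walk G u v → V → Set
  TwoEdgesAt p x = Σ E λ e → Σ E λ e' →
    e ≢ e' × e ∈ edges G p × e' ∈ edges G p × Incident e x × Incident e' x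

  path-interior-two-edges : ∀ {u v} (p : Walk G u v) → IsPath G p → ∀ {x} → x ∈ verts G p →
                            x ≢ u → x ≢ v → TwoEdgesAt p x
  path-interior-two-edges []           _ (here refl) x≢u _ = ⊥-elim (x≢u refl)
  path-interior-two-edges (step _ _ _) _ (here refl) x≢u _ = ⊥-elim (x≢u refl)
  path-interior-two-edges (step {w = w} e j p) (u∉p ∷ path) {x} (there x∈) _ x≢v with x ≟ w
  ... | no x≢w with path-interior-two-edges p path x∈ x≢w x≢v
  ...   | f , f' , f≢f' , f∈ , f'∈ , inc , inc' = f , f' , f≢f' , there f∈ , there f'∈ , inc , inc'
  path-interior-two-edges (step e j []) _ _ _ x≢v | yes refl = ⊥-elim (x≢v refl)
  path-interior-two-edges (step e j (step e' j' p)) (u∉p ∷ _) _ _ _ | yes refl =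
    e , e' , e≢e' , here refl , there (here refl) , joins⇒incidentʳ j , joins⇒incidentˡ j'
    where
    e≢e' : e ≢ e'
    e≢e' refl = All.lookup u∉p (there (start∈verts p)) (joins-functional (joins-sym j) j')

  walkIn-≼ : ∀ H {u v u' v'} {p : Walk G u v} {q : Walk G u' v'} → q ≼ p → WalkIn G H p → WalkIn G H q
  walkIn-≼ H q≼p (p-vs , p-es) = All.tabulate (λ x∈ → All.lookup p-vs (verts⊆ q≼p x∈))
                               , All.tabulate (λ e∈ → All.lookup p-es (edges⊆ q≼p e∈))

  walkIn-step : ∀ H {u w v e} (j : Joins G e u w) {p : Walk G w v} →
                e ∈ₛ ES H → WalkIn G H p → WalkIn G H (step e j p)
  walkIn-step H j e∈ (p-vs , p-es) =
    incidentIn⇒∈VS H (e∈ , joins⇒incidentˡ j) All.∷ p-vs , e∈ All.∷ p-es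

  walkIn-++ : ∀ H {u v w} (p : Walk G u v) (q : Walk G v w) →
              WalkIn G H p → WalkIn G H q → WalkIn G H (p ++ʷ q)
  walkIn-++ H []           q _                                q-in = q-in
  walkIn-++ H (step e j p) q (_ All.∷ p-vs , e∈ All.∷ p-es) q-in =
    walkIn-step H j e∈ (walkIn-++ H p q (p-vs , p-es) q-in)

  walkIn-reverse : ∀ H {u v} (p : Walk G u v) → WalkIn G H p → WalkIn G H (reverse p)
  walkIn-reverse H p = walkIn-≼ H (reverse≼ p)

  trivialPathIn : ∀ H {x} → x ∈ₛ VS H → PathIn G H x x
  trivialPathIn H x∈ = [] , ([] ∷ []) , (x∈ All.∷ [] , [])

  shortcutIn : ∀ H {u v} (p : Walk G u v) → WalkIn G H p → Σ (PathIn G H u v) λ P → proj₁ P ≼ p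
  shortcutIn H p p-in = let (q , q-path , q≼p) = shortcut p in (q , q-path , walkIn-≼ H q≼p p-in) , q≼p

  Acyclic : Subgraph G → Set
  Acyclic H = ¬ HasCycle G H

  _⊑_ : Subgraph G → Subgraph G → Set
  H ⊑ H' = VS H ⊆ₛ VS H' × ES H ⊆ₛ ES H'

  walkIn-⊑ : ∀ H H' → H ⊑ H' → ∀ {u v} {p : Walk G u v} → WalkIn G H p → WalkIn G H' p
  walkIn-⊑ H H' (VS⊆ , ES⊆) (p-vs , p-es) = All.map VS⊆ p-vs , All.map ES⊆ p-es

  acyclic-⊑ : ∀ H H' → H ⊑ H' → Acyclic H' → Acyclic H
  acyclic-⊑ H H' H⊑H' acyclic (u , v , u≢v , (p , p-path , p-in) , e , e∈ , j , e∉) =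
    acyclic (u , v , u≢v , (p , p-path , walkIn-⊑ H H' H⊑H' p-in) , e , proj₂ H⊑H' e∈ , j , e∉)

  closing-edge⇒cycle : ∀ H {u w e} (p : Walk G u w) → WalkIn G H p →
                       e ∈ₛ ES H → Joins G e w u → e ∉ edges G p → HasCycle G H
  closing-edge⇒cycle H p p-in e∈ j e∉p =
    let (P , P≼p) = shortcutIn H p p-in in
    _ , _ , joins⇒≢ (joins-sym j) , P , _ , e∈ , j , λ e∈P → e∉p (edges⊆ P≼p e∈P)

  -- If the second vertex w of P is not on Q, the first edge of P closes Q followed by P backwards
  -- from v to w into a cycle.
  acyclic⇒path-verts-⊆ : ∀ H → Acyclic H → ∀ {u v} (P Q : PathIn G H u v) →
                         verts G (proj₁ P) ⊆ verts G (proj₁ Q)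
  acyclic⇒path-verts-⊆ H _ ([] , _)           (q , _) (here refl) = start∈verts q
  acyclic⇒path-verts-⊆ H _ (step _ _ _ , _)   (q , _) (here refl) = start∈verts q
  acyclic⇒path-verts-⊆ H acyclic (step {w = w} e j p , u∉p ∷ p-path , _ All.∷ p-vs , e∈ All.∷ p-es)
                       (q , q-path , q-in) (there x∈) with w ∈ₗ? verts G q
  ... | yes w∈q = let (q' , q'-path , q'≼q) = suffix q q-path w∈q in
    verts⊆ q'≼q (acyclic⇒path-verts-⊆ H acyclic (p , p-path , p-vs , p-es)
                                                (q' , q'-path , walkIn-≼ H q'≼q q-in) x∈)
  ... | no w∉q = ⊥-elim (acyclic (closing-edge⇒cycle H (q ++ʷ reverse p) qp-in e∈ (joins-sym j) e∉))
    where
    e∉ : e ∉ edges G (q ++ʷ reverse p)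
    e∉ e∈qp with ∈-edges-++⁻ q (reverse p) e∈qp
    ... | inj₁ e∈q = w∉q (incident∈verts q e∈q (joins⇒incidentʳ j))
    ... | inj₂ e∈p = All.lookup u∉p (incident∈verts p (edges⊆ (reverse≼ p) e∈p) (joins⇒incidentˡ j)) refl
    qp-in : WalkIn G H (q ++ʷ reverse p)
    qp-in = walkIn-++ H q (reverse p) q-in (walkIn-reverse H p (p-vs , p-es))

  acyclic⇒reverse-path-verts-⊆ : ∀ H → Acyclic H → ∀ {u v} (P : PathIn G H u v) (Q : PathIn G H v u) →
                                 verts G (proj₁ P) ⊆ verts G (proj₁ Q)
  acyclic⇒reverse-path-verts-⊆ H acyclic P (q , _ , q-in) x∈ =
    let (Q' , Q'≼) = shortcutIn H (reverse q) (walkIn-reverse H q q-in) in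
    verts⊆ (reverse≼ q) (verts⊆ Q'≼ (acyclic⇒path-verts-⊆ H acyclic P Q' x∈))

  acyclic-path-split : ∀ H → Acyclic H → ∀ {a b c x} (P : PathIn G H b c) → x ∈ verts G (proj₁ P) →
                       (A : PathIn G H a b) (C : PathIn G H a c) →
                       x ∈ verts G (proj₁ A) ⊎ x ∈ verts G (proj₁ C)
  acyclic-path-split H acyclic P x∈ (a , _ , a-in) (c , _ , c-in)
    with shortcutIn H (reverse a ++ʷ c) (walkIn-++ H (reverse a) c (walkIn-reverse H a a-in) c-in)
  ... | P' , P'≼ with ∈-verts-++⁻ (reverse a) c (verts⊆ P'≼ (acyclic⇒path-verts-⊆ H acyclic P P' x∈))
  ...   | inj₁ x∈a = inj₁ (verts⊆ (reverse≼ a) x∈a)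
  ...   | inj₂ x∈c = inj₂ x∈c

  -- An edge at z other than the first edge of P closes a cycle with the prefix of P up to its
  -- other end.
  acyclic-start-degree≤1 : ∀ H → Acyclic H → ∀ {z b} (P : PathIn G H z b) →
                           (∀ {e} → IncidentIn H z e → other e z ∈ verts G (proj₁ P)) → degree G H z ≤ 1
  acyclic-start-degree≤1 H _ ([] , _) neighbours = atMostOne⇒degree≤1 H (λ inc _ → ⊥-elim (no-edge inc))
    where
    no-edge : ∀ {e} → IncidentIn H _ e → ⊥
    no-edge (e∈ , inc) with neighbours (e∈ , inc)
    ... | here w≡z = joins⇒≢ (incident⇒joins-other inc) (sym w≡z)
  acyclic-start-degree≤1 H acyclic {z} (step f j p , z∉p ∷ _ , P-in) neighbours =
    atMostOne⇒degree≤1 H (λ inc inc' → trans (is-first inc) (sym (is-first inc')))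
    where
    is-first : ∀ {e} → IncidentIn H z e → e ≡ f
    is-first {e} (e∈ , inc) with e ≟ f | prefix (step f j p) (neighbours (e∈ , inc))
    ... | yes e≡f | _       = e≡f
    ... | no e≢f  | q , q≼P = ⊥-elim (acyclic (closing-edge⇒cycle H q (walkIn-≼ H q≼P P-in) e∈
                                                 (joins-sym (incident⇒joins-other inc)) e∉q))
      where
      e∉q : e ∉ edges G q
      e∉q e∈q with edges⊆ q≼P e∈q
      ... | here e≡f  = e≢f e≡f
      ... | there e∈p = All.lookup z∉p (incident∈verts p e∈p inc) refl

  vertexSet : List V → Subset (n G)
  vertexSet xs = ⟦ _∈ₗ? xs ⟧

  vertexSet-∷-⊃ : ∀ {w xs} → w ∉ xs → vertexSet (w ∷ xs) ⊃ vertexSet xs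
  vertexSet-∷-⊃ {w} {xs} w∉ = (λ x∈ → ∈⟦⟧⁺ (_∈ₗ? (w ∷ xs)) (there (∈⟦⟧⁻ (_∈ₗ? xs) x∈)))
                            , w , ∈⟦⟧⁺ (_∈ₗ? (w ∷ xs)) (here refl) , (λ w∈ → w∉ (∈⟦⟧⁻ (_∈ₗ? xs) w∈))

  acyclic-path-extends-to-degree≤1 : ∀ H → Acyclic H → ∀ {y b} (P : PathIn G H y b) →
    Σ V λ z → Σ (PathIn G H z b) λ P' → verts G (proj₁ P) ⊆ verts G (proj₁ P') × degree G H z ≤ 1
  acyclic-path-extends-to-degree≤1 H acyclic P = go P (⊃-wellFounded _)
    where
    go : ∀ {y b} (P : PathIn G H y b) → Acc _⊃_ (vertexSet (verts G (proj₁ P))) →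
         Σ V λ z → Σ (PathIn G H z b) λ P' → verts G (proj₁ P) ⊆ verts G (proj₁ P') × degree G H z ≤ 1
    go {y} P@(p , p-path , p-in) (acc longer)
      with any? (λ e → (e ∈? ES H) ×-dec incident? e y ×-dec ¬? (other e y ∈ₗ? verts G p))
    ... | yes (e , e∈ , inc , w∉) =
      let j = joins-sym (incident⇒joins-other inc)
          (z , P' , p⊆P' , d≤1) = go (step e j p , ¬Any⇒All¬ _ w∉ ∷ p-path , walkIn-step H j e∈ p-in)
                                     (longer (vertexSet-∷-⊃ w∉))
      in z , P' , (λ x∈ → p⊆P' (there x∈)) , d≤1
    ... | no maximal = y , P , ⊆-refl , acyclic-start-degree≤1 H acyclic P on-path
      where
      on-path : ∀ {e} → IncidentIn H y e → other e y ∈ verts G p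
      on-path {e} (e∈ , inc) =
        decidable-stable (other e y ∈ₗ? verts G p) (λ w∉ → maximal (e , e∈ , inc , w∉))

  steiner-degree≤1⇒terminal : ∀ {R T} → SteinerTree G R T → ∀ {z b} (P : PathIn G T z b) →
                              z ≢ b → degree G T z ≤ 1 → z ∈ₛ R
  steiner-degree≤1⇒terminal _ ([] , _) z≢b _ = ⊥-elim (z≢b refl)
  steiner-degree≤1⇒terminal {T = T} (_ , _ , leaves⊆R) (step f j _ , _ , z∈ All.∷ _ , f∈ All.∷ _) _ d≤1 =
    leaves⊆R _ (z∈ , ≤-antisym d≤1 (degree≥1 T (f∈ , joins⇒incidentˡ j)))

  OnPath : Subgraph G → V → V → V → Set
  OnPath H x a b = Σ (PathIn G H a b) λ P → x ∈ verts G (proj₁ P)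

  SeparatesTerminals : Subset (n G) → Subgraph G → V → Set
  SeparatesTerminals R T x = Σ V λ u → Σ V λ v → u ∈ₛ R × v ∈ₛ R × x ≢ u × x ≢ v × OnPath T x u v

  steiner-branching⇒separates : ∀ {R T} → SteinerTree G R T → ∀ {x} → x ∈ₛ VS T → 2 ≤ degree G T x →
                                SeparatesTerminals R T x
  steiner-branching⇒separates {T = T} st@((_ , _ , acyclic) , _) {x} x∈ 2≤d
    with acyclic-path-extends-to-degree≤1 T acyclic (trivialPathIn T x∈)
  ... | z₁ , P₁@(p₁ , _ , p₁-in) , _ , d₁
    with shortcutIn T (reverse p₁) (walkIn-reverse T p₁ p₁-in)
  ... | P₁⁻¹ , _ with acyclic-path-extends-to-degree≤1 T acyclic P₁⁻¹
  ... | z₂ , P₂ , P₁⁻¹⊆P₂ , d₂ =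
    z₂ , z₁ , steiner-degree≤1⇒terminal st P₂ z₂≢z₁ d₂ , steiner-degree≤1⇒terminal st P₁ z₁≢x d₁ ,
    ≢-sym z₂≢x , ≢-sym z₁≢x , P₂ , x∈P₂
    where
    low-degree≢x : ∀ {z} → degree G T z ≤ 1 → z ≢ x
    low-degree≢x d≤1 refl = <⇒≱ 2≤d d≤1
    z₁≢x = low-degree≢x d₁
    z₂≢x = low-degree≢x d₂
    x∈P₂ : x ∈ verts G (proj₁ P₂)
    x∈P₂ = P₁⁻¹⊆P₂ (start∈verts (proj₁ P₁⁻¹))
    z₂≢z₁ : z₂ ≢ z₁
    z₂≢z₁ refl = z₁≢x (sym (closed-path-trivial (proj₁ P₂) (proj₁ (proj₂ P₂)) x∈P₂))

  pathIn-ends∈VS : ∀ H {a b} (P : PathIn G H a b) → a ∈ₛ VS H × b ∈ₛ VS H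
  pathIn-ends∈VS H (p , _ , p-vs , _) = All.lookup p-vs (start∈verts p) , All.lookup p-vs (end∈verts p)

  tree-onPath-sym : ∀ T → IsTree G T → ∀ {x a b} → OnPath T x a b → OnPath T x b a
  tree-onPath-sym T (_ , connected , acyclic) (P , x∈P) =
    let (a∈ , b∈) = pathIn-ends∈VS T P
        Q = connected _ _ b∈ a∈
    in Q , acyclic⇒reverse-path-verts-⊆ T acyclic P Q x∈P

  tree-onPath-split : ∀ T → IsTree G T → ∀ {x a b c} → a ∈ₛ VS T →
                      OnPath T x b c → OnPath T x a b ⊎ OnPath T x a c
  tree-onPath-split T (_ , connected , acyclic) a∈ (P , x∈P) =
    let (b∈ , c∈) = pathIn-ends∈VS T P
        A = connected _ _ a∈ b∈
        C = connected _ _ a∈ c∈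
    in map-⊎ (A ,_) (C ,_) (acyclic-path-split T acyclic P x∈P A C)

  int : Subgraph G → Subset (n G)
  int T = ⟦ (λ x → (x ∈? VS T) ×-dec (2 ≤? degree G T x)) ⟧

  ∈int⁺ : ∀ T {x} → x ∈ₛ VS T → 2 ≤ degree G T x → x ∈ₛ int T
  ∈int⁺ T x∈ 2≤d = ∈⟦⟧⁺ (λ x → (x ∈? VS T) ×-dec (2 ≤? degree G T x)) (x∈ , 2≤d)

  ∈int⁻ : ∀ T {x} → x ∈ₛ int T → x ∈ₛ VS T × 2 ≤ degree G T x
  ∈int⁻ T = ∈⟦⟧⁻ (λ x → (x ∈? VS T) ×-dec (2 ≤? degree G T x))

  path-interior⊆int : ∀ H {a b} (P : PathIn G H a b) {z} → z ∈ verts G (proj₁ P) →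
                      z ≢ a → z ≢ b → z ∈ₛ int H
  path-interior⊆int H (p , p-path , p-vs , p-es) z∈ z≢a z≢b =
    let (e , e' , e≢e' , e∈ , e'∈ , inc , inc') = path-interior-two-edges p p-path z∈ z≢a z≢b in
    ∈int⁺ H (All.lookup p-vs z∈)
            (degree≥2 H e≢e' (All.lookup p-es e∈ , inc) (All.lookup p-es e'∈ , inc'))

  int-connected : ∀ T → SubConnected G T → InducedConnected G (int T)
  int-connected T connected x y x∈ y∈ = proj₁ P , All.tabulate on-int
    where
    P = connected x y (proj₁ (∈int⁻ T x∈)) (proj₁ (∈int⁻ T y∈))
    on-int : ∀ {z} → z ∈ verts G (proj₁ P) → z ∈ₛ int T
    on-int {z} z∈ with z ≟ x | z ≟ y
    ... | yes refl | _        = x∈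
    ... | no _     | yes refl = y∈
    ... | no z≢x   | no z≢y   = path-interior⊆int T P z∈ z≢x z≢y

  steiner-int-dominating : ∀ {R T} → Independent G R → 2 ≤ ∣ R ∣ → SteinerTree G R T →
                           ConnDominating G R (int T)
  steiner-int-dominating {R} {T} independent 2≤∣R∣ ((_ , connected , _) , R⊆VS , _) =
    int-connected T connected , dominated
    where
    dominated : ∀ r → r ∈ₛ R → r ∈ₛ int T ⊎ Σ E λ e → Σ V λ q → Joins G e r q × q ∈ₛ int T
    dominated r r∈ with ∃-other-element R 2≤∣R∣ r
    ... | r' , r'∈ , r'≢r with connected r r' (R⊆VS r r∈) (R⊆VS r' r'∈)
    ...   | [] , _ = ⊥-elim (r'≢r refl)
    ...   | P@(step {w = w} e j p , _) =
      inj₂ (e , w , j , path-interior⊆int T P (there (start∈verts p)) (≢-sym (joins⇒≢ j)) w≢r')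
      where
      w≢r' : w ≢ r'
      w≢r' refl = independent e r w j r∈ r'∈

  module _ {R : Subset (n G)} {k} {T : Fin k → Subgraph G} (cist : CIST G R k T) where

    cist-no-common-interior : ∀ {i j} → i ≢ j → ∀ {x a b} → a ∈ₛ R → b ∈ₛ R → x ≢ a → x ≢ b →
                              OnPath (T i) x a b → OnPath (T j) x a b → ⊥
    cist-no-common-interior i≢j {a = a} {b} a∈ b∈ x≢a x≢b (P , x∈P) (Q , x∈Q) with a ≟ b
    ... | yes refl = x≢a (closed-path-trivial (proj₁ P) (proj₁ (proj₂ P)) x∈P)
    ... | no a≢b   = [ x≢a , x≢b ]′ (proj₂ (proj₂ cist a b a∈ b∈ a≢b _ _ i≢j P Q) _ x∈P x∈Q)

    cist-int-disjoint : PairwiseDisjoint G (λ i → int (T i))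
    cist-int-disjoint i j i≢j x x∈i x∈j =
      let (u₁ , v₁ , u₁∈ , v₁∈ , x≢u₁ , x≢v₁ , S₁) = branch i x∈i
          (u₂ , v₂ , u₂∈ , v₂∈ , x≢u₂ , x≢v₂ , S₂) = branch j x∈j
          (a , b , (a∈ , x≢a) , (b∈ , x≢b) , Sᵢ , Sⱼ) =
            common-separated-pair {Terminal = λ a → a ∈ₛ R × x ≢ a}
              (tree-onPath-sym (T i) (tree i)) (tree-onPath-sym (T j) (tree j)) (split i) (split j)
              (u₁∈ , x≢u₁) (v₁∈ , x≢v₁) (u₂∈ , x≢u₂) (v₂∈ , x≢v₂) S₁ S₂
      in cist-no-common-interior i≢j a∈ b∈ x≢a x≢b Sᵢ Sⱼ
      where
      tree : ∀ i → IsTree G (T i)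
      tree i = proj₁ (proj₁ cist i)
      branch : ∀ i → x ∈ₛ int (T i) → SeparatesTerminals R (T i) x
      branch i x∈ = let (x∈VS , 2≤d) = ∈int⁻ (T i) x∈ in
                    steiner-branching⇒separates (proj₁ cist i) x∈VS 2≤d
      split : ∀ i {a b c} → a ∈ₛ R × x ≢ a → OnPath (T i) x b c →
              OnPath (T i) x a b ⊎ OnPath (T i) x a c
      split i (a∈ , _) = tree-onPath-split (T i) (tree i) (proj₁ (proj₂ (proj₁ cist i)) _ a∈)

    cist⇒disjoint-dominating : Independent G R → 2 ≤ ∣ R ∣ →
      Σ (Fin k → Subset (n G)) λ V → PairwiseDisjoint G V × (∀ i → ConnDominating G R (V i))
    cist⇒disjoint-dominating independent 2≤∣R∣ =
      (λ i → int (T i)) , cist-int-disjoint ,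
      λ i → steiner-int-dominating independent 2≤∣R∣ (proj₁ cist i)

  atMostOne-⊑ : ∀ H H' → H ⊑ H' → ∀ {x} → AtMostOneEdgeAt H' x → AtMostOneEdgeAt H x
  atMostOne-⊑ H H' (_ , ES⊆) one (e∈ , inc) (e'∈ , inc') = one (ES⊆ e∈ , inc) (ES⊆ e'∈ , inc')

  cycle-avoids-low-degree : ∀ H {x} → AtMostOneEdgeAt H x → ∀ {u v e} (P : PathIn G H u v) →
                            e ∈ₛ ES H → Joins G e v u → e ∉ edges G (proj₁ P) → x ∉ verts G (proj₁ P)
  cycle-avoids-low-degree H {x} one {u} {v} {e} (p , p-path , _ , p-es) e∈ j e∉ x∈ with x ≟ u | x ≟ v
  ... | yes refl | _ = let (f , f∈ , inc) = first-edge p (joins⇒≢ (joins-sym j)) in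
    e∉ (subst (_∈ edges G p) (one (All.lookup p-es f∈ , inc) (e∈ , joins⇒incidentʳ j)) f∈)
  ... | no _ | yes refl = let (f , f∈ , inc) = last-edge p (joins⇒≢ (joins-sym j)) in
    e∉ (subst (_∈ edges G p) (one (All.lookup p-es f∈ , inc) (e∈ , joins⇒incidentˡ j)) f∈)
  ... | no x≢u | no x≢v =
    let (f , f' , f≢f' , f∈ , f'∈ , inc , inc') = path-interior-two-edges p p-path x∈ x≢u x≢v in
    f≢f' (one (All.lookup p-es f∈ , inc) (All.lookup p-es f'∈ , inc'))

  singleton : V → Subgraph G
  singleton x = sub ⁅ x ⁆ ⊥ₛ (λ _ e∈ → ⊥-elim (∉⊥ e∈))

  singleton-acyclic : ∀ x → Acyclic (singleton x)
  singleton-acyclic x (_ , _ , _ , _ , _ , e∈ , _) = ∉⊥ e∈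

  singleton-connected : ∀ x → SubConnected G (singleton x)
  singleton-connected x u v u∈ v∈ with x∈⁅y⁆⇒x≡y x u∈ | x∈⁅y⁆⇒x≡y x v∈
  ... | refl | refl = trivialPathIn (singleton x) u∈

  module _ (H : Subgraph G) {e a b} (j : Joins G e a b) (a∈ : a ∈ₛ VS H) where

    attach : Subgraph G
    attach = sub (VS H ∪ ⁅ b ⁆) (ES H ∪ ⁅ e ⁆) closed'
      where
      end∈ : ∀ {z} → Incident e z → z ∈ₛ VS H ∪ ⁅ b ⁆
      end∈ inc with incident-joins j inc
      ... | inj₁ refl = ∈-∪⁅⁆⁺ b a∈
      ... | inj₂ refl = y∈-∪⁅y⁆ b
      closed' : ∀ f → f ∈ₛ ES H ∪ ⁅ e ⁆ →
                proj₁ (ends G f) ∈ₛ VS H ∪ ⁅ b ⁆ × proj₂ (ends G f) ∈ₛ VS H ∪ ⁅ b ⁆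
      closed' f f∈ with ∈-∪⁅⁆⁻ (ES H) e f∈
      ... | inj₁ f∈H  = ∈-∪⁅⁆⁺ b (proj₁ (closed H f f∈H)) , ∈-∪⁅⁆⁺ b (proj₂ (closed H f f∈H))
      ... | inj₂ refl = end∈ (inj₁ refl) , end∈ (inj₂ refl)

    ⊑-attach : H ⊑ attach
    ⊑-attach = ∈-∪⁅⁆⁺ b , ∈-∪⁅⁆⁺ e

    b∈attach : b ∈ₛ VS attach
    b∈attach = y∈-∪⁅y⁆ b

    incidentIn-attach⁻ : ∀ {x f} → IncidentIn attach x f → IncidentIn H x f ⊎ (f ≡ e × (x ≡ a ⊎ x ≡ b))
    incidentIn-attach⁻ (f∈ , inc) with ∈-∪⁅⁆⁻ (ES H) e f∈
    ... | inj₁ f∈H  = inj₁ (f∈H , inc)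
    ... | inj₂ refl = inj₂ (refl , incident-joins j inc)

    attach-connected : SubConnected G H → SubConnected G attach
    attach-connected connected u v u∈ v∈ =
      proj₁ (shortcutIn attach (proj₁ (walk u∈ v∈)) (proj₂ (walk u∈ v∈)))
      where
      lift : ∀ {x y} → PathIn G H x y → Σ (Walk G x y) (WalkIn G attach)
      lift (p , _ , p-in) = p , walkIn-⊑ H attach ⊑-attach p-in
      e∈ : e ∈ₛ ES attach
      e∈ = y∈-∪⁅y⁆ e
      walk : ∀ {x y} → x ∈ₛ VS attach → y ∈ₛ VS attach → Σ (Walk G x y) (WalkIn G attach)
      walk {x} {y} x∈ y∈ with ∈-∪⁅⁆⁻ (VS H) b x∈ | ∈-∪⁅⁆⁻ (VS H) b y∈
      ... | inj₁ x∈H | inj₁ y∈H = lift (connected x y x∈H y∈H)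
      ... | inj₁ x∈H | inj₂ refl =
        let (p , p-in) = lift (connected x a x∈H a∈) in
        p ++ʷ step e j [] ,
        walkIn-++ attach p (step e j []) p-in (walkIn-step attach j e∈ (b∈attach All.∷ [] , []))
      ... | inj₂ refl | inj₁ y∈H =
        let (p , p-in) = lift (connected a y a∈ y∈H) in
        step e (joins-sym j) p , walkIn-step attach (joins-sym j) e∈ p-in
      ... | inj₂ refl | inj₂ refl = [] , (b∈attach All.∷ [] , [])

    module _ (b∉ : b ∉ₛ VS H) where

      attach-atMostOne-new : AtMostOneEdgeAt attach b
      attach-atMostOne-new inc inc' = trans (is-e inc) (sym (is-e inc'))
        where
        is-e : ∀ {f} → IncidentIn attach b f → f ≡ e
        is-e inc with incidentIn-attach⁻ inc
        ... | inj₁ incH       = ⊥-elim (b∉ (incidentIn⇒∈VS H incH))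
        ... | inj₂ (f≡e , _)  = f≡e

      attach-atMostOne : ∀ {x} → x ≢ a → (x ∈ₛ VS H → AtMostOneEdgeAt H x) → AtMostOneEdgeAt attach x
      attach-atMostOne {x} x≢a one with x ≟ b
      ... | yes refl = attach-atMostOne-new
      ... | no x≢b   = λ inc inc' → one (incidentIn⇒∈VS H (old inc)) (old inc) (old inc')
        where
        old : ∀ {f} → IncidentIn attach x f → IncidentIn H x f
        old inc with incidentIn-attach⁻ inc
        ... | inj₁ incH              = incH
        ... | inj₂ (_ , inj₁ x≡a)    = ⊥-elim (x≢a x≡a)
        ... | inj₂ (_ , inj₂ x≡b)    = ⊥-elim (x≢b x≡b)

      attach-acyclic : Acyclic H → Acyclic attach
      attach-acyclic acyclic (u , v , u≢v , P@(p , p-path , p-vs , p-es) , f , f∈ , jf , f∉) =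
        acyclic (u , v , u≢v , (p , p-path , All.tabulate in-VS , All.tabulate in-ES) ,
                 f , f∈H , jf , f∉)
        where
        b∉p : b ∉ verts G p
        b∉p = cycle-avoids-low-degree attach attach-atMostOne-new P f∈ jf f∉
        old-edge : ∀ {g} → g ∈ₛ ES attach → (∀ {z} → Incident g z → z ∈ verts G p) → g ∈ₛ ES H
        old-edge g∈ ends∈p with ∈-∪⁅⁆⁻ (ES H) e g∈
        ... | inj₁ g∈H  = g∈H
        ... | inj₂ refl = ⊥-elim (b∉p (ends∈p (joins⇒incidentʳ j)))
        in-VS : ∀ {y} → y ∈ verts G p → y ∈ₛ VS H
        in-VS y∈ with ∈-∪⁅⁆⁻ (VS H) b (All.lookup p-vs y∈)
        ... | inj₁ y∈H  = y∈H
        ... | inj₂ refl = ⊥-elim (b∉p y∈)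
        in-ES : ∀ {g} → g ∈ edges G p → g ∈ₛ ES H
        in-ES g∈ = old-edge (All.lookup p-es g∈) (incident∈verts p g∈)
        f∈H : f ∈ₛ ES H
        f∈H = old-edge f∈ λ inc →
          [ (λ { refl → end∈verts p }) , (λ { refl → start∈verts p }) ]′ (incident-joins jf inc)


  module _ (H : Subgraph G) (x : V) where

    private
      keepV? : Decidable (λ y → y ∈ₛ VS H × y ≢ x)
      keepV? y = (y ∈? VS H) ×-dec ¬? (y ≟ x)

      keepE? : Decidable (λ f → f ∈ₛ ES H × ¬ Incident f x)
      keepE? f = (f ∈? ES H) ×-dec ¬? (incident? f x)

    delete : Subgraph G
    delete = sub ⟦ keepV? ⟧ ⟦ keepE? ⟧ closed'
      where
      closed' : ∀ f → f ∈ₛ ⟦ keepE? ⟧ → proj₁ (ends G f) ∈ₛ ⟦ keepV? ⟧ × proj₂ (ends G f) ∈ₛ ⟦ keepV? ⟧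
      closed' f f∈ = let (f∈H , ¬inc) = ∈⟦⟧⁻ keepE? f∈ in
        ∈⟦⟧⁺ keepV? (proj₁ (closed H f f∈H) , λ eq → ¬inc (inj₁ (sym eq))) ,
        ∈⟦⟧⁺ keepV? (proj₂ (closed H f f∈H) , λ eq → ¬inc (inj₂ (sym eq)))

    delete-⊑ : delete ⊑ H
    delete-⊑ = (λ y∈ → proj₁ (∈⟦⟧⁻ keepV? y∈)) , (λ f∈ → proj₁ (∈⟦⟧⁻ keepE? f∈))

    delete-⊂ : x ∈ₛ VS H → VS delete ⊂ VS H
    delete-⊂ x∈ = proj₁ delete-⊑ , x , x∈ , λ x∈' → proj₂ (∈⟦⟧⁻ keepV? x∈') refl

    ∈VS-delete⁺ : ∀ {y} → y ∈ₛ VS H → y ≢ x → y ∈ₛ VS delete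
    ∈VS-delete⁺ y∈ y≢x = ∈⟦⟧⁺ keepV? (y∈ , y≢x)

    delete-connected : SubConnected G H → degree G H x ≤ 1 → SubConnected G delete
    delete-connected connected d≤1 u v u∈ v∈ = p , p-path , All.tabulate in-VS , All.tabulate in-ES
      where
      u∈H = ∈⟦⟧⁻ keepV? u∈
      v∈H = ∈⟦⟧⁻ keepV? v∈
      P = connected u v (proj₁ u∈H) (proj₁ v∈H)
      p = proj₁ P
      p-path = proj₁ (proj₂ P)
      p-vs = proj₁ (proj₂ (proj₂ P))
      p-es = proj₂ (proj₂ (proj₂ P))
      x∉p : x ∉ verts G p
      x∉p x∈ = let (e , e' , e≢e' , e∈ , e'∈ , inc , inc') =
                     path-interior-two-edges p p-path x∈ (≢-sym (proj₂ u∈H)) (≢-sym (proj₂ v∈H)) in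
               e≢e' (degree≤1⇒atMostOne H d≤1 (All.lookup p-es e∈ , inc) (All.lookup p-es e'∈ , inc'))
      in-VS : ∀ {y} → y ∈ verts G p → y ∈ₛ VS delete
      in-VS y∈ = ∈⟦⟧⁺ keepV? (All.lookup p-vs y∈ , λ { refl → x∉p y∈ })
      in-ES : ∀ {f} → f ∈ edges G p → f ∈ₛ ES delete
      in-ES f∈ = ∈⟦⟧⁺ keepE? (All.lookup p-es f∈ , λ inc → x∉p (incident∈verts p f∈ inc))

  record Scaffold (R Q : Subset (n G)) : Set where
    field
      tree            : Subgraph G
      acyclic         : Acyclic tree
      connected       : SubConnected G tree
      ⊆Q∪R            : ∀ {x} → x ∈ₛ VS tree → x ∈ₛ Q ⊎ x ∈ₛ R
      atMostOne-off-Q : ∀ {x} → x ∈ₛ VS tree → x ∉ₛ Q → AtMostOneEdgeAt tree x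

  module _ {R Q : Subset (n G)} where
    open Scaffold

    singleton-scaffold : ∀ {q} → q ∈ₛ Q → Scaffold R Q
    singleton-scaffold {q} q∈ = record
      { tree            = singleton q
      ; acyclic         = singleton-acyclic q
      ; connected       = singleton-connected q
      ; ⊆Q∪R            = λ x∈ → inj₁ (in-Q x∈)
      ; atMostOne-off-Q = λ x∈ x∉Q → ⊥-elim (x∉Q (in-Q x∈))
      }
      where
      in-Q : ∀ {x} → x ∈ₛ ⁅ q ⁆ → x ∈ₛ Q
      in-Q x∈ = subst (_∈ₛ Q) (sym (x∈⁅y⁆⇒x≡y q x∈)) q∈

    -- The far end of e is written other e a so that Frontier is decidable.
    Frontier : Subgraph G → E → V → Set
    Frontier T e a = Incident e a × a ∈ₛ VS T × a ∈ₛ Q ×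
                     other e a ∉ₛ VS T × (other e a ∈ₛ Q ⊎ other e a ∈ₛ R)

    frontier? : ∀ T e a → Dec (Frontier T e a)
    frontier? T e a = incident? e a ×-dec (a ∈? VS T) ×-dec (a ∈? Q) ×-dec ¬? (other e a ∈? VS T)
                      ×-dec ((other e a ∈? Q) ⊎-dec (other e a ∈? R))

    frontier : ∀ {T e a b} → Joins G e a b → a ∈ₛ VS T → a ∈ₛ Q → b ∉ₛ VS T → b ∈ₛ Q ⊎ b ∈ₛ R →
               Frontier T e a
    frontier {T} j a∈ a∈Q b∉ b∈ = joins⇒incidentˡ j , a∈ , a∈Q ,
      subst (λ b → b ∉ₛ VS T × (b ∈ₛ Q ⊎ b ∈ₛ R)) (joins⇒≡other j) (b∉ , b∈)

    Saturated : Subgraph G → Set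
    Saturated T = ∀ e a → ¬ Frontier T e a

    extend : (S : Scaffold R Q) → ∀ {e a} → Frontier (tree S) e a → Scaffold R Q
    extend S {e} {a} (inc , a∈ , a∈Q , b∉ , b∈) = record
      { tree            = attach T j a∈
      ; acyclic         = attach-acyclic T j a∈ b∉ (acyclic S)
      ; connected       = attach-connected T j a∈ (connected S)
      ; ⊆Q∪R            = λ x∈ → [ ⊆Q∪R S , (λ { refl → b∈ }) ]′ (∈-∪⁅⁆⁻ (VS T) _ x∈)
      ; atMostOne-off-Q = λ x∈ x∉Q → attach-atMostOne T j a∈ b∉ (λ { refl → x∉Q a∈Q })
                                                       (λ x∈T → atMostOne-off-Q S x∈T x∉Q)
      }
      where
      T = tree S
      j = incident⇒joins-other inc

    extend-⊃ : (S : Scaffold R Q) → ∀ {e a} (fr : Frontier (tree S) e a) →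
               VS (tree (extend S fr)) ⊃ VS (tree S)
    extend-⊃ S {e} {a} (_ , _ , _ , b∉ , _) = ∈-∪⁅⁆⁺ (other e a) , other e a , y∈-∪⁅y⁆ (other e a) , b∉

    grow : (S : Scaffold R Q) → Acc _⊃_ (VS (tree S)) →
           Σ (Scaffold R Q) λ S' → VS (tree S) ⊆ₛ VS (tree S') × Saturated (tree S')
    grow S (acc larger) with any? (λ e → any? (frontier? (tree S) e))
    ... | no none = S , id , λ e a fr → none (e , a , fr)
    ... | yes (e , a , fr) =
      let (S' , ⊆S' , saturated) = grow (extend S fr) (larger (extend-⊃ S fr)) in
      S' , (λ x∈ → ⊆S' (∈-∪⁅⁆⁺ (other e a) x∈)) , saturated

    saturated-walk : ∀ T → Saturated T → ∀ {s y} (p : Walk G s y) →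
                     s ∈ₛ VS T → All (_∈ₛ Q) (verts G p) → y ∈ₛ VS T
    saturated-walk _ _ [] s∈ _ = s∈
    saturated-walk T saturated (step {w = w} e j p) s∈ (s∈Q All.∷ p-Q) with w ∈? VS T
    ... | yes w∈ = saturated-walk T saturated p w∈ p-Q
    ... | no w∉  =
      ⊥-elim (saturated e _ (frontier {T} j s∈ s∈Q w∉ (inj₁ (All.lookup p-Q (start∈verts p)))))

    TerminalsIn : Subgraph G → Set
    TerminalsIn T = ∀ r → r ∈ₛ R → r ∈ₛ VS T

    saturated-covers : ConnDominating G R Q → ∀ T {q} → Saturated T → q ∈ₛ VS T → q ∈ₛ Q → TerminalsIn T
    saturated-covers (Q-connected , dominating) T {q} saturated q∈ q∈Q r r∈ =
      [ Q⊆T , (λ { (e , q' , j , q'∈Q) → neighbour-covered e j q'∈Q }) ]′ (dominating r r∈)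
      where
      Q⊆T : ∀ {y} → y ∈ₛ Q → y ∈ₛ VS T
      Q⊆T y∈Q = let (p , p-Q) = Q-connected q _ q∈Q y∈Q in saturated-walk T saturated p q∈ p-Q
      neighbour-covered : ∀ e {q'} → Joins G e r q' → q' ∈ₛ Q → r ∈ₛ VS T
      neighbour-covered e j q'∈Q = decidable-stable (r ∈? VS T) λ r∉ →
        saturated e _ (frontier {T} (joins-sym j) (Q⊆T q'∈Q) q'∈Q r∉ (inj₂ r∈))

    shrink : (S : Scaffold R Q) → ∀ {x} → degree G (tree S) x ≤ 1 → Scaffold R Q
    shrink S {x} d≤1 = record
      { tree            = delete T x
      ; acyclic         = acyclic-⊑ (delete T x) T (delete-⊑ T x) (acyclic S)
      ; connected       = delete-connected T x (connected S) d≤1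
      ; ⊆Q∪R            = λ y∈ → ⊆Q∪R S (proj₁ (delete-⊑ T x) y∈)
      ; atMostOne-off-Q = λ y∈ y∉Q → atMostOne-⊑ (delete T x) T (delete-⊑ T x)
                                                   (atMostOne-off-Q S (proj₁ (delete-⊑ T x) y∈) y∉Q)
      }
      where
      T = tree S

    prune : (S : Scaffold R Q) → TerminalsIn (tree S) → Acc _⊂_ (VS (tree S)) →
            Σ (Scaffold R Q) λ S' → TerminalsIn (tree S') ×
                                    (∀ x → x ∈ₛ VS (tree S') → x ∉ₛ R → 2 ≤ degree G (tree S') x)
    prune S R⊆T (acc smaller)
      with any? (λ x → (x ∈? VS (tree S)) ×-dec ¬? (x ∈? R) ×-dec (degree G (tree S) x ≤? 1))
    ... | yes (x , x∈ , x∉R , d≤1) =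
      prune (shrink S d≤1) (λ r r∈ → ∈VS-delete⁺ (tree S) x (R⊆T r r∈) λ { refl → x∉R r∈ })
            (smaller (delete-⊂ (tree S) x x∈))
    ... | no none = S , R⊆T , λ x x∈ x∉R → ≰⇒> λ d≤1 → none (x , x∈ , x∉R , d≤1)

    steiner-scaffold : 2 ≤ ∣ R ∣ → ConnDominating G R Q →
                       Σ (Scaffold R Q) λ S → SteinerTree G R (tree S)
    steiner-scaffold 2≤∣R∣ cd@(_ , dominating) =
      let (r , r∈) = ∃-element R (≤-trans (n≤1+n 1) 2≤∣R∣)
          (q , q∈Q) = seed r r∈
          (S₁ , q⊆S₁ , saturated) = grow (singleton-scaffold q∈Q) (⊃-wellFounded _)
          q∈S₁ = q⊆S₁ (x∈⁅x⁆ q)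
          (S₂ , R⊆T , branching) =
            prune S₁ (saturated-covers cd (tree S₁) saturated q∈S₁ q∈Q) (⊂-wellFounded _)
      in S₂ , ((r , R⊆T r r∈) , connected S₂ , acyclic S₂) , R⊆T , λ x (x∈ , d≡1) →
           decidable-stable (x ∈? R) λ x∉R → <⇒≱ (branching x x∈ x∉R) (≤-reflexive d≡1)
      where
      seed : ∀ r → r ∈ₛ R → Σ V (_∈ₛ Q)
      seed r r∈ = [ (λ r∈Q → r , r∈Q) , (λ { (_ , q , _ , q∈Q) → q , q∈Q }) ]′ (dominating r r∈)

  module _ {R : Subset (n G)} (independent : Independent G R) {k} {Q : Fin k → Subset (n G)}
           (disjoint : PairwiseDisjoint G Q) (S : ∀ i → Scaffold R (Q i))
           (steiner : ∀ i → SteinerTree G R (Scaffold.tree (S i))) where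
    open Scaffold

    private
      T : Fin k → Subgraph G
      T i = tree (S i)

    path-interior∈Q : ∀ i {u v} (P : PathIn G (T i) u v) {x} → x ∈ verts G (proj₁ P) →
                      x ≢ u → x ≢ v → x ∈ₛ Q i
    path-interior∈Q i (p , p-path , p-vs , p-es) {x} x∈ x≢u x≢v = decidable-stable (x ∈? Q i) λ x∉Q →
      let (e , e' , e≢e' , e∈ , e'∈ , inc , inc') = path-interior-two-edges p p-path x∈ x≢u x≢v in
      e≢e' (atMostOne-off-Q (S i) (All.lookup p-vs x∈) x∉Q
                            (All.lookup p-es e∈ , inc) (All.lookup p-es e'∈ , inc'))

    shared-vertex∈R : ∀ {i j} → i ≢ j → ∀ {x} → x ∈ₛ VS (T i) → x ∈ₛ VS (T j) → x ∈ₛ R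
    shared-vertex∈R {i} {j} i≢j {x} x∈i x∈j with ⊆Q∪R (S i) x∈i | ⊆Q∪R (S j) x∈j
    ... | inj₂ x∈R  | _         = x∈R
    ... | inj₁ _    | inj₂ x∈R  = x∈R
    ... | inj₁ x∈Qi | inj₁ x∈Qj = ⊥-elim (disjoint i j i≢j x x∈Qi x∈Qj)

    scaffolds⇒cist : CIST G R k T
    scaffolds⇒cist = steiner , λ _ _ _ _ _ _ _ i≢j P₁ P₂ →
      edge-disjoint i≢j P₁ P₂ , vertex-disjoint i≢j P₁ P₂
      where
      edge-disjoint : ∀ {i j} → i ≢ j → ∀ {u v} (P₁ : PathIn G (T i) u v) (P₂ : PathIn G (T j) u v) →
                      ∀ e → e ∈ edges G (proj₁ P₁) → e ∈ edges G (proj₁ P₂) → ⊥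
      edge-disjoint i≢j (p₁ , _ , p₁-vs , _) (p₂ , _ , p₂-vs , _) e e∈₁ e∈₂ =
        independent e _ _ (inj₁ refl) (end∈R (inj₁ refl)) (end∈R (inj₂ refl))
        where
        end∈R : ∀ {z} → Incident e z → z ∈ₛ R
        end∈R inc = shared-vertex∈R i≢j (All.lookup p₁-vs (incident∈verts p₁ e∈₁ inc))
                                        (All.lookup p₂-vs (incident∈verts p₂ e∈₂ inc))
      vertex-disjoint : ∀ {i j} → i ≢ j → ∀ {u v} (P₁ : PathIn G (T i) u v) (P₂ : PathIn G (T j) u v) →
                        ∀ x → x ∈ verts G (proj₁ P₁) → x ∈ verts G (proj₁ P₂) → x ≡ u ⊎ x ≡ v
      vertex-disjoint {i} {j} i≢j {u} {v} P₁ P₂ x x∈₁ x∈₂ with x ≟ u | x ≟ v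
      ... | yes x≡u | _       = inj₁ x≡u
      ... | no _    | yes x≡v = inj₂ x≡v
      ... | no x≢u  | no x≢v  =
        ⊥-elim (disjoint i j i≢j x (path-interior∈Q i P₁ x∈₁ x≢u x≢v)
                                   (path-interior∈Q j P₂ x∈₂ x≢u x≢v))

  disjoint-dominating⇒cist : ∀ {R} → Independent G R → 2 ≤ ∣ R ∣ → ∀ {k} (Q : Fin k → Subset (n G)) →
                             PairwiseDisjoint G Q → (∀ i → ConnDominating G R (Q i)) → HasCIST G R k
  disjoint-dominating⇒cist independent 2≤∣R∣ Q disjoint dominating =
    (λ i → Scaffold.tree (S i)) ,
    scaffolds⇒cist independent disjoint S (λ i → proj₂ (steiner-scaffold 2≤∣R∣ (dominating i)))
    where
    S : ∀ i → Scaffold _ (Q i)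
    S i = proj₁ (steiner-scaffold 2≤∣R∣ (dominating i))

theorem3p15 : (G : Graph) → Connected G → (R : Subset (n G)) → Independent G R →
    2 ≤ ∣ R ∣ → (k : ℕ) →
    HasCIST G R k ⇔ (Σ (Fin k → Subset (n G)) λ V →
      PairwiseDisjoint G V × (∀ i → ConnDominating G R (V i)))
theorem3p15 G _ R independent 2≤∣R∣ k = mk⇔
  (λ { (_ , cist) → cist⇒disjoint-dominating G cist independent 2≤∣R∣ })
  (λ { (Q , disjoint , dominating) →
        disjoint-dominating⇒cist G independent 2≤∣R∣ Q disjoint dominating })
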